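{- Let $K$ be a field of characteristic $0$, $r,m,n\ge1$ integers, $A(X)=\prod_{i=1}^r(X+\eta_i)$ and $B(X)=\prod_{j=1}^r(X+\zeta_j)$ with $\eta_i,\zeta_j\in K$. Let $(\gamma_w)_{1\le w\le r(n+1)-1}$ be elements of $K$ with $\gamma_w=\zeta_{r+1-w}$ for $1\le w\le r$. For $0\le s\le r-1$ let $a_{0,s}\in K$ be the constant coefficient in the unique expansion $$\prod_{j=1}^nA(X-j)=\sum_{k=0}^{rn}a_{k,s}\prod_{w=1}^k(X+\gamma_{r-s-1+w})$$ (the empty product being $1$). Then the following are equivalent: (i) $\prod_{s=0}^{r-1}a_{0,s}^m\neq0$; (ii) $\eta_i-k-\zeta_j\neq0$ for all $1\le i,j\le r$ and $1\le k\le n$. -}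

module Defs where

open import Level using (Level; _⊔_)
open import Data.Nat using (ℕ; zero; suc)
open import Data.Product using (Σ; ∃; _×_; _,_)
open import Data.List using (List; []; _∷_)
open import Relation.Nullary using (¬_)
open import Algebra.Bundles using (CommutativeRing; Semiring)
import Algebra.Definitions.RawSemiring as RawSemiringDefs

record Field (c ℓ : Level) : Set (Level.suc (c ⊔ ℓ)) where
  field
    commutativeRing : CommutativeRing c ℓ
  open CommutativeRing commutativeRing public
  field
    0≉1     : ¬ (0# ≈ 1#)
    inverse : ∀ x → ¬ (x ≈ 0#) → ∃ λ y → (x * y) ≈ 1#

module FieldOps {c ℓ} (K : Field c ℓ) where
  open Field K
  open RawSemiringDefs (Semiring.rawSemiring (CommutativeRing.semiring commutativeRing)) public using (_^_) renaming (_×_ to _·1×_)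

  ι : ℕ → Carrier
  ι n = n ·1× 1#

  CharZero : Set ℓ
  CharZero = ∀ n → ¬ (ι (suc n) ≈ 0#)

  sumTo : ℕ → (ℕ → Carrier) → Carrier
  sumTo zero    f = 0#
  sumTo (suc N) f = sumTo N f + f N

  prodTo : ℕ → (ℕ → Carrier) → Carrier
  prodTo zero    f = 1#
  prodTo (suc N) f = prodTo N f * f N

  -- Formal univariate polynomials over K as coefficient lists
  -- (constant coefficient first); equality is coefficientwise,
  -- with missing coefficients read as 0.
  Poly : Set c
  Poly = List Carrier

  coeff : Poly → ℕ → Carrier
  coeff []       _       = 0#
  coeff (a ∷ p)  zero    = a
  coeff (a ∷ p)  (suc i) = coeff p i

  _≋_ : Poly → Poly → Set ℓ
  p ≋ q = ∀ i → coeff p i ≈ coeff q i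

  one : Poly
  one = 1# ∷ []

  _⊕_ : Poly → Poly → Poly
  []      ⊕ q       = q
  (a ∷ p) ⊕ []      = a ∷ p
  (a ∷ p) ⊕ (b ∷ q) = (a + b) ∷ (p ⊕ q)

  scale : Carrier → Poly → Poly
  scale c []      = []
  scale c (a ∷ p) = (c * a) ∷ scale c p

  linMul : Carrier → Poly → Poly
  linMul c p = (0# ∷ p) ⊕ scale c p

  mulLins : ℕ → (ℕ → Carrier) → Poly → Poly
  mulLins zero    f p = p
  mulLins (suc N) f p = linMul (f N) (mulLins N f p)

  linProd : ℕ → (ℕ → Carrier) → Poly
  linProd N f = mulLins N f one

  linProd2 : ℕ → ℕ → (ℕ → ℕ → Carrier) → Poly
  linProd2 zero    M g = one
  linProd2 (suc N) M g = mulLins M (g N) (linProd2 N M g)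

  polySum : ℕ → (ℕ → Poly) → Poly
  polySum zero    F = []
  polySum (suc N) F = polySum N F ⊕ F N

{-# OPTIONS --safe #-}
-- Evaluating the expansion of ∏_{j=1}^n A(X - j) at X = -ζ_{s+1} kills every term
-- with k ≥ 1, because the first factor X + γ_{r-s} of the basis polynomials is
-- X + ζ_{s+1}. Hence a_{0,s} = ∏_{j=1}^n ∏_{i=1}^r (η_i - j - ζ_{s+1}), and in a
-- field a finite product of powers is nonzero exactly when every factor is.
module Submission where

open import Defs
open import Data.Nat using (ℕ; zero; suc; _∸_; _≤_; _<_; z≤n; s≤s)
import Data.Nat as ℕ
import Data.Nat.Properties as ℕ
open import Data.Product using (_×_; _,_)
open import Data.Sum using (inj₁; inj₂)
open import Data.List using ([]; _∷_)
open import Function.Bundles using (_⇔_; mk⇔)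
open import Relation.Nullary using (¬_)
open import Relation.Binary.PropositionalEquality as ≡ using (_≡_)
import Algebra.Properties.CommutativeSemigroup as CommutativeSemigroupProperties

first-basis-index-bounds : ∀ {r s} → s < r → 1 ≤ r ∸ s ∸ 1 ℕ.+ 1 × r ∸ s ∸ 1 ℕ.+ 1 ≤ r
first-basis-index-bounds {r} {s} s<r = ℕ.m≤n+m 1 (r ∸ s ∸ 1) , ℕ.≤-trans w≤r∸s (ℕ.m∸n≤m r s)
  where
  w≤r∸s : r ∸ s ∸ 1 ℕ.+ 1 ≤ r ∸ s
  w≤r∸s = ℕ.≤-reflexive (ℕ.m∸n+n≡m (ℕ.m<n⇒0<n∸m s<r))

first-basis-index-reflected : ∀ {r s} → s < r → r ℕ.+ 1 ∸ (r ∸ s ∸ 1 ℕ.+ 1) ≡ suc s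
first-basis-index-reflected {r} {s} s<r = begin
  r ℕ.+ 1 ∸ (r ∸ s ∸ 1 ℕ.+ 1) ≡⟨ ≡.cong (r ℕ.+ 1 ∸_) (ℕ.m∸n+n≡m (ℕ.m<n⇒0<n∸m s<r)) ⟩
  r ℕ.+ 1 ∸ (r ∸ s)           ≡⟨ ℕ.+-∸-comm 1 (ℕ.m∸n≤m r s) ⟩
  r ∸ (r ∸ s) ℕ.+ 1           ≡⟨ ≡.cong (ℕ._+ 1) (ℕ.m∸[m∸n]≡n (ℕ.<⇒≤ s<r)) ⟩
  s ℕ.+ 1                     ≡⟨ ℕ.+-comm s 1 ⟩
  suc s                       ∎
  where open ≡.≡-Reasoning

module _ {c ℓ} (K : Field c ℓ) where
  open Field K
  open FieldOps K
  open import Relation.Binary.Reasoning.Setoid setoid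
  open CommutativeSemigroupProperties +-commutativeSemigroup
    using () renaming (interchange to +-interchange)
  open CommutativeSemigroupProperties *-commutativeSemigroup
    using () renaming (interchange to *-interchange; x∙yz≈y∙xz to *-leftSwap)

  eval : Carrier → Poly → Carrier
  eval x []      = 0#
  eval x (a ∷ p) = a + x * eval x p

  module _ (x : Carrier) where

    eval-≋[] : ∀ q → [] ≋ q → eval x q ≈ 0#
    eval-≋[] []      _   = refl
    eval-≋[] (b ∷ q) []≋q = begin
      b + x * eval x q ≈⟨ +-cong (sym ([]≋q 0)) (*-congˡ (eval-≋[] q (λ i → []≋q (suc i)))) ⟩
      0# + x * 0#      ≈⟨ +-identityˡ _ ⟩
      x * 0#           ≈⟨ zeroʳ x ⟩
      0#               ∎

    eval-cong : ∀ p q → p ≋ q → eval x p ≈ eval x q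
    eval-cong []      q       p≋q = sym (eval-≋[] q p≋q)
    eval-cong (a ∷ p) []      p≋q = eval-≋[] (a ∷ p) (λ i → sym (p≋q i))
    eval-cong (a ∷ p) (b ∷ q) p≋q =
      +-cong (p≋q 0) (*-congˡ (eval-cong p q (λ i → p≋q (suc i))))

    eval-⊕ : ∀ p q → eval x (p ⊕ q) ≈ eval x p + eval x q
    eval-⊕ []      q       = sym (+-identityˡ _)
    eval-⊕ (a ∷ p) []      = sym (+-identityʳ _)
    eval-⊕ (a ∷ p) (b ∷ q) = begin
      (a + b) + x * eval x (p ⊕ q)                ≈⟨ +-congˡ (*-congˡ (eval-⊕ p q)) ⟩
      (a + b) + x * (eval x p + eval x q)         ≈⟨ +-congˡ (distribˡ x _ _) ⟩
      (a + b) + (x * eval x p + x * eval x q)     ≈⟨ +-interchange a b _ _ ⟩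
      (a + x * eval x p) + (b + x * eval x q)     ∎

    eval-scale : ∀ k p → eval x (scale k p) ≈ k * eval x p
    eval-scale k []      = sym (zeroʳ k)
    eval-scale k (a ∷ p) = begin
      k * a + x * eval x (scale k p) ≈⟨ +-congˡ (*-congˡ (eval-scale k p)) ⟩
      k * a + x * (k * eval x p)     ≈⟨ +-congˡ (*-leftSwap x k _) ⟩
      k * a + k * (x * eval x p)     ≈⟨ distribˡ k a _ ⟨
      k * (a + x * eval x p)         ∎

    eval-linMul : ∀ k p → eval x (linMul k p) ≈ eval x p * (x + k)
    eval-linMul k p = begin
      eval x ((0# ∷ p) ⊕ scale k p)            ≈⟨ eval-⊕ (0# ∷ p) (scale k p) ⟩
      (0# + x * eval x p) + eval x (scale k p) ≈⟨ +-cong (+-identityˡ _) (eval-scale k p) ⟩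
      x * eval x p + k * eval x p              ≈⟨ distribʳ (eval x p) x k ⟨
      (x + k) * eval x p                       ≈⟨ *-comm _ _ ⟩
      eval x p * (x + k)                       ∎

    eval-mulLins : ∀ N f p → eval x (mulLins N f p) ≈ eval x p * prodTo N (λ w → x + f w)
    eval-mulLins zero    f p = sym (*-identityʳ _)
    eval-mulLins (suc N) f p = begin
      eval x (linMul (f N) (mulLins N f p))         ≈⟨ eval-linMul (f N) (mulLins N f p) ⟩
      eval x (mulLins N f p) * (x + f N)            ≈⟨ *-congʳ (eval-mulLins N f p) ⟩
      (eval x p * prodTo N (λ w → x + f w)) * (x + f N) ≈⟨ *-assoc _ _ _ ⟩
      eval x p * prodTo (suc N) (λ w → x + f w)     ∎

    eval-one : eval x one ≈ 1#
    eval-one = trans (+-congˡ (zeroʳ x)) (+-identityʳ 1#)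

    eval-linProd : ∀ N f → eval x (linProd N f) ≈ prodTo N (λ w → x + f w)
    eval-linProd N f = trans (eval-mulLins N f one) (trans (*-congʳ eval-one) (*-identityˡ _))

    eval-linProd2 : ∀ N M g →
      eval x (linProd2 N M g) ≈ prodTo N (λ j → prodTo M (λ i → x + g j i))
    eval-linProd2 zero    M g = eval-one
    eval-linProd2 (suc N) M g =
      trans (eval-mulLins M (g N) (linProd2 N M g)) (*-congʳ (eval-linProd2 N M g))

    eval-polySum : ∀ N F → eval x (polySum N F) ≈ sumTo N (λ k → eval x (F k))
    eval-polySum zero    F = refl
    eval-polySum (suc N) F = trans (eval-⊕ (polySum N F) (F N)) (+-congʳ (eval-polySum N F))

  prodTo-cong : ∀ N {f g} → (∀ k → f k ≈ g k) → prodTo N f ≈ prodTo N g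
  prodTo-cong zero    f≈g = refl
  prodTo-cong (suc N) f≈g = *-cong (prodTo-cong N f≈g) (f≈g N)

  sumTo-head : ∀ N F → (∀ k → F (suc k) ≈ 0#) → sumTo (suc N) F ≈ F 0
  sumTo-head zero    F tail≈0 = +-identityˡ _
  sumTo-head (suc N) F tail≈0 =
    trans (+-cong (sumTo-head N F tail≈0) (tail≈0 N)) (+-identityʳ _)

  prodTo-zero : ∀ N f {s} → s < N → f s ≈ 0# → prodTo N f ≈ 0#
  prodTo-zero (suc N) f s<1+N fs≈0 with ℕ.m<1+n⇒m<n∨m≡n s<1+N
  ... | inj₁ s<N    = trans (*-congʳ (prodTo-zero N f s<N fs≈0)) (zeroˡ _)
  ... | inj₂ ≡.refl = trans (*-congˡ fs≈0) (zeroʳ _)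

  ^-zero : ∀ m {a} → a ≈ 0# → a ^ suc m ≈ 0#
  ^-zero m a≈0 = trans (*-congʳ a≈0) (zeroˡ _)

  1≉0 : 1# ≉ 0#
  1≉0 1≈0 = 0≉1 (sym 1≈0)

  *-nonzero : ∀ {a b} → a ≉ 0# → b ≉ 0# → a * b ≉ 0#
  *-nonzero {a} {b} a≉0 b≉0 ab≈0 with inverse a a≉0 | inverse b b≉0
  ... | a⁻¹ , aa⁻¹≈1 | b⁻¹ , bb⁻¹≈1 = 1≉0 (begin
    1#                      ≈⟨ *-identityʳ 1# ⟨
    1# * 1#                 ≈⟨ *-cong aa⁻¹≈1 bb⁻¹≈1 ⟨
    (a * a⁻¹) * (b * b⁻¹)   ≈⟨ *-interchange a a⁻¹ b b⁻¹ ⟩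
    (a * b) * (a⁻¹ * b⁻¹)   ≈⟨ *-congʳ ab≈0 ⟩
    0# * (a⁻¹ * b⁻¹)        ≈⟨ zeroˡ _ ⟩
    0#                      ∎)

  prodTo-nonzero : ∀ N f → (∀ s → s < N → f s ≉ 0#) → prodTo N f ≉ 0#
  prodTo-nonzero zero    f _       = 1≉0
  prodTo-nonzero (suc N) f factors≉0 =
    *-nonzero (prodTo-nonzero N f (λ s s<N → factors≉0 s (ℕ.m≤n⇒m≤1+n s<N)))
              (factors≉0 N ℕ.≤-refl)

  ^-nonzero : ∀ m {a} → a ≉ 0# → a ^ m ≉ 0#
  ^-nonzero zero    a≉0 = 1≉0
  ^-nonzero (suc m) a≉0 = *-nonzero a≉0 (^-nonzero m a≉0)

  -- Every basis polynomial ∏_{w<k} (X + f w) with k ≥ 1 vanishes at a root of X + f 0,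
  -- so evaluating there isolates the constant coordinate c 0.
  expansion-coeff₀ : ∀ {N} → 0 < N → (c : ℕ → Carrier) → ∀ f p x → x + f 0 ≈ 0# →
    polySum N (λ k → scale (c k) (linProd k f)) ≋ p → c 0 ≈ eval x p
  expansion-coeff₀ {suc N} _ c f p x root expansion = begin
    c 0                                      ≈⟨ *-identityʳ _ ⟨
    c 0 * 1#                                 ≈⟨ *-congˡ (eval-one x) ⟨
    c 0 * eval x one                         ≈⟨ eval-scale x (c 0) one ⟨
    eval x (term 0)                          ≈⟨ sumTo-head N (λ k → eval x (term k)) higher-terms≈0 ⟨
    sumTo (suc N) (λ k → eval x (term k))    ≈⟨ eval-polySum x (suc N) term ⟨
    eval x (polySum (suc N) term)            ≈⟨ eval-cong x (polySum (suc N) term) p expansion ⟩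
    eval x p                                 ∎
    where
    term : ℕ → Poly
    term k = scale (c k) (linProd k f)

    higher-terms≈0 : ∀ k → eval x (term (suc k)) ≈ 0#
    higher-terms≈0 k = begin
      eval x (term (suc k))                           ≈⟨ eval-scale x (c (suc k)) (linProd (suc k) f) ⟩
      c (suc k) * eval x (linProd (suc k) f)          ≈⟨ *-congˡ (eval-linProd x (suc k) f) ⟩
      c (suc k) * prodTo (suc k) (λ w → x + f w)      ≈⟨ *-congˡ (prodTo-zero (suc k) _ (s≤s z≤n) root) ⟩
      c (suc k) * 0#                                  ≈⟨ zeroʳ _ ⟩
      0#                                              ∎

  constant-coefficient : ∀ r n (η ζ γ : ℕ → Carrier) →
    (∀ w → 1 ≤ w → w ≤ r → γ w ≈ ζ (r ℕ.+ 1 ∸ w)) →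
    (a : ℕ → Carrier) → ∀ {s} → s < r →
    polySum (r ℕ.* n ℕ.+ 1) (λ k → scale (a k) (linProd k (λ w′ → γ (r ∸ s ∸ 1 ℕ.+ suc w′))))
      ≋ linProd2 n r (λ j i → η (suc i) - ι (suc j)) →
    a 0 ≈ prodTo n (λ j → prodTo r (λ i → (η (suc i) - ι (suc j)) - ζ (suc s)))
  constant-coefficient r n η ζ γ γ≈ζ a {s} s<r expansion = begin
    a 0
      ≈⟨ expansion-coeff₀ (ℕ.m≤n+m 1 (r ℕ.* n)) a _ target (- ζ (suc s)) root expansion ⟩
    eval (- ζ (suc s)) target
      ≈⟨ eval-linProd2 (- ζ (suc s)) n r _ ⟩
    prodTo n (λ j → prodTo r (λ i → - ζ (suc s) + (η (suc i) - ι (suc j))))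
      ≈⟨ prodTo-cong n (λ j → prodTo-cong r (λ i → +-comm _ _)) ⟩
    prodTo n (λ j → prodTo r (λ i → (η (suc i) - ι (suc j)) - ζ (suc s))) ∎
    where
    target : Poly
    target = linProd2 n r (λ j i → η (suc i) - ι (suc j))

    root : - ζ (suc s) + γ (r ∸ s ∸ 1 ℕ.+ 1) ≈ 0#
    root with first-basis-index-bounds s<r
    ... | 1≤w , w≤r = begin
      - ζ (suc s) + γ (r ∸ s ∸ 1 ℕ.+ 1)               ≈⟨ +-congˡ (γ≈ζ _ 1≤w w≤r) ⟩
      - ζ (suc s) + ζ (r ℕ.+ 1 ∸ (r ∸ s ∸ 1 ℕ.+ 1))   ≡⟨ ≡.cong (λ t → - ζ (suc s) + ζ t) (first-basis-index-reflected s<r) ⟩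
      - ζ (suc s) + ζ (suc s)                         ≈⟨ -‿inverseˡ _ ⟩
      0#                                              ∎

proposition4p5 : ∀ {c ℓ} (K : Field c ℓ) → let open Field K in let open FieldOps K in
    CharZero →
    (r m n : ℕ) → 1 ≤ r → 1 ≤ m → 1 ≤ n →
    -- η i , ζ j for 1 ≤ i, j ≤ r ; γ w for 1 ≤ w ≤ r(n+1)-1 (other values irrelevant)
    (η ζ γ : ℕ → Carrier) →
    (∀ w → 1 ≤ w → w ≤ r → γ w ≈ ζ (r ℕ.+ 1 ∸ w)) →
    -- a k s : the coefficients of the expansion, for 0 ≤ k ≤ rn, 0 ≤ s ≤ r-1
    (a : ℕ → ℕ → Carrier) →
    -- ∏_{j=1}^n A(X-j) = Σ_{k=0}^{rn} a_{k,s} ∏_{w=1}^k (X + γ_{r-s-1+w}),  A(X-j) = ∏_i (X + η_i - j)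
    (∀ s → s < r →
      polySum (r ℕ.* n ℕ.+ 1) (λ k → scale (a k s) (linProd k (λ w′ → γ (r ∸ s ∸ 1 ℕ.+ suc w′))))
      ≋ linProd2 n r (λ j i → η (suc i) - ι (suc j))) →
    (¬ (prodTo r (λ s → a 0 s ^ m) ≈ 0#))
    ⇔ (∀ i j k → 1 ≤ i → i ≤ r → 1 ≤ j → j ≤ r → 1 ≤ k → k ≤ n →
         ¬ ((η i - ι k) - ζ j ≈ 0#))
proposition4p5 K _ r (suc m) n _ _ _ η ζ γ γ≈ζ a expansion =
  mk⇔ ∏≉0⇒factors≉0 factors≉0⇒∏≉0
  where
  open Field K
  open FieldOps K

  FactorsNonzero : Set _
  FactorsNonzero = ∀ i j k → 1 ≤ i → i ≤ r → 1 ≤ j → j ≤ r → 1 ≤ k → k ≤ n →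
                ¬ ((η i - ι k) - ζ j ≈ 0#)

  a₀ : ∀ {s} → s < r →
       a 0 s ≈ prodTo n (λ j → prodTo r (λ i → (η (suc i) - ι (suc j)) - ζ (suc s)))
  a₀ s<r = constant-coefficient K r n η ζ γ γ≈ζ (λ k → a k _) s<r (expansion _ s<r)

  ∏≉0⇒factors≉0 : prodTo r (λ s → a 0 s ^ suc m) ≉ 0# → FactorsNonzero
  ∏≉0⇒factors≉0 ∏≉0 (suc i) (suc j) (suc k) _ i≤r _ j≤r _ k≤n factor≈0 =
    ∏≉0 (prodTo-zero K r _ j≤r (^-zero K m (trans (a₀ j≤r)
      (prodTo-zero K n _ k≤n (prodTo-zero K r _ i≤r factor≈0)))))

  factors≉0⇒∏≉0 : FactorsNonzero → prodTo r (λ s → a 0 s ^ suc m) ≉ 0#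
  factors≉0⇒∏≉0 factors≉0 = prodTo-nonzero K r _ λ s s<r →
    ^-nonzero K (suc m) λ a₀≈0 → prodTo-nonzero K n _
      (λ k k<n → prodTo-nonzero K r _ λ i i<r →
        factors≉0 (suc i) (suc s) (suc k) (s≤s z≤n) i<r (s≤s z≤n) s<r (s≤s z≤n) k<n)
      (trans (sym (a₀ s<r)) a₀≈0)
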